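{- Any octagonal-square grid is $(5,1)$-total-threshold-colorable: for every edge-labeling $\ell$ of it there is a $(5,1)$-threshold-coloring with respect to $\ell$.
   Context: An octagonal-square grid is a finite portion of the graph of the planar tiling by regular octagons and squares (the 4.8.8 truncated square tiling). An edge-labeling of $G=(V,E)$ is a map $\ell:E\to\{N,F\}$. For integers $r\ge1$, $t\ge0$, an $(r,t)$-threshold-coloring of $G$ with respect to $\ell$ is a map $c:V\to\{1,\dots,r\}$ such that for every edge $uv\in E$: $\ell(uv)=N$ iff $|c(u)-c(v)|\le t$. -}

module Defs where

open import Data.Nat using (ℕ; _≤_; ∣_-_∣)
open import Data.Integer using (ℤ; _+_; +_)
open import Data.Product using (_×_; _,_)
open import Data.List using (List)
open import Data.List.Membership.Propositional using (_∈_)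
open import Function.Bundles using (_⇔_)
open import Relation.Binary.PropositionalEquality using (_≡_)

-- The infinite 4.8.8 (truncated square) tiling graph.
-- Every vertex lies in exactly one square; squares are indexed by
-- lattice points p ∈ ℤ², and the four corners of a square are
-- R (right), T (top), L (left), B (bottom) (squares drawn as diamonds).
data Corner : Set where
  R T L B : Corner

Pt : Set
Pt = ℤ × ℤ

V : Set
V = Pt × Corner

-- Edges of the tiling, each with a unique name:
--   four square edges per square, plus
--   hor p : R-corner of square p  —  L-corner of square p+(1,0)
--   ver p : T-corner of square p  —  B-corner of square p+(0,1)
-- (the octagons are bounded by the squares at p, p+(1,0), p+(1,1), p+(0,1)).
data E : Set where
  sqRT sqTL sqLB sqBR : Pt → E
  hor ver : Pt → E

ends : E → V × V
ends (sqRT p) = (p , R) , (p , T)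
ends (sqTL p) = (p , T) , (p , L)
ends (sqLB p) = (p , L) , (p , B)
ends (sqBR p) = (p , B) , (p , R)
ends (hor (x , y)) = ((x , y) , R) , ((x + + 1 , y) , L)
ends (ver (x , y)) = ((x , y) , T) , ((x , y + + 1) , B)

record OctSquareGrid : Set where
  field
    vertices : List V
    edges    : List E
    edges-ok : ∀ e → e ∈ edges →
               let (u , v) = ends e in (u ∈ vertices) × (v ∈ vertices)
open OctSquareGrid public

data Label : Set where
  N F : Label

-- An edge-labeling of G; it is given on all tiling edges, only the
-- values on edges of G are relevant.
EdgeLabeling : Set
EdgeLabeling = E → Label

IsThresholdColoring : ℕ → ℕ → OctSquareGrid → EdgeLabeling → (V → ℕ) → Set
IsThresholdColoring r t G ℓ c =
  (∀ v → v ∈ vertices G → (1 ≤ c v) × (c v ≤ r)) ×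
  (∀ e → e ∈ edges G →
     let (u , v) = ends e in (ℓ e ≡ N) ⇔ (∣ c u - c v ∣ ≤ t))

module Submission where

-- Colour every R-corner of the tiling with 3; every other vertex
-- gets a colour in {1,2,4,5}.  Such a colour is determined by two bits: its
-- side of 3 (low = {1,2}, high = {4,5}) and its distance to 3 (near = {2,4},
-- far = {1,5}).  Two colours of {1,2,4,5} differ by at most 1 iff they lie on
-- the same side, and such a colour is within 1 of 3 iff it is near.
--
-- Every non-R vertex has exactly one R-neighbour; we make it near iff that
-- edge is labelled N, which settles all edges at R-corners.  The remaining
-- edges split the T-, L- and B-corners into disjoint bi-infinite paths, one per
-- column:  … – B(x,y) – L(x,y) – T(x,y) – B(x,y+1) – …  Along such a path we
-- choose sides so that consecutive vertices share their side iff the edge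
-- between them is labelled N; since a path has no cycles this is always
-- possible (lemma Chain).  The theorem is obtained by restricting this
-- colouring of the whole tiling to the finite grid G.

open import Defs
open import Data.Bool using () renaming (T to True)
open import Data.Empty using (⊥-elim)
open import Data.Integer using (ℤ; +_; -[1+_]) renaming (_+_ to _+ᶻ_; _-_ to _-ᶻ_)
import Data.Integer.Properties as ℤP
open import Data.Nat using (ℕ; zero; suc; _≤_; _≤ᵇ_; ∣_-_∣)
import Data.Nat.Properties as ℕP
open import Data.Product using (Σ; _×_; _,_)
open import Function.Bundles using (_⇔_; mk⇔)
open import Relation.Binary.PropositionalEquality
  using (_≡_; refl; sym; trans; cong; subst; module ≡-Reasoning)

≤-by-evaluation : ∀ {m n} {_ : True (m ≤ᵇ n)} → m ≤ n
≤-by-evaluation {m} {n} {m≤ᵇn} = ℕP.≤ᵇ⇒≤ m n m≤ᵇn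

-- The colour difference n meets the demand of label l with threshold 1,
-- in a form that can be established clause by clause.
Realises : Label → ℕ → Set
Realises N n = n ≤ 1
Realises F n = 2 ≤ n

realises⇒iff : ∀ l n → Realises l n → (l ≡ N) ⇔ (n ≤ 1)
realises⇒iff N n n≤1 = mk⇔ (λ _ → n≤1) (λ _ → refl)
realises⇒iff F n 2≤n = mk⇔ (λ ()) (λ n≤1 → ⊥-elim (ℕP.<⇒≱ 2≤n n≤1))

realises-sym : ∀ l m n → Realises l ∣ m - n ∣ → Realises l ∣ n - m ∣
realises-sym l m n = subst (Realises l) (ℕP.∣-∣-comm m n)

-- The side of 3 on which a vertex is coloured; crossing an F-edge of a
-- column path switches sides, crossing an N-edge keeps the side.
data Side : Set where
  low high : Side

across : Label → Side → Side
across N s    = s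
across F low  = high
across F high = low

across-involutive : ∀ l s → across l (across l s) ≡ s
across-involutive N s    = refl
across-involutive F low  = refl
across-involutive F high = refl

-- The colour of a vertex on side s whose edge to its R-neighbour carries
-- label d: near colours 2 and 4 for d = N, far colours 1 and 5 for d = F.
colourOf : Side → Label → ℕ
colourOf low  N = 2
colourOf low  F = 1
colourOf high N = 4
colourOf high F = 5

colourOf-range : ∀ s d → (1 ≤ colourOf s d) × (colourOf s d ≤ 5)
colourOf-range low  N = ≤-by-evaluation , ≤-by-evaluation
colourOf-range low  F = ≤-by-evaluation , ≤-by-evaluation
colourOf-range high N = ≤-by-evaluation , ≤-by-evaluation
colourOf-range high F = ≤-by-evaluation , ≤-by-evaluation

centre-realised : ∀ s d → Realises d ∣ colourOf s d - 3 ∣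
centre-realised low  N = ≤-by-evaluation
centre-realised low  F = ≤-by-evaluation
centre-realised high N = ≤-by-evaluation
centre-realised high F = ≤-by-evaluation

across-realised : ∀ l s m n → Realises l ∣ colourOf s m - colourOf (across l s) n ∣
across-realised N low  N N = ≤-by-evaluation
across-realised N low  N F = ≤-by-evaluation
across-realised N low  F N = ≤-by-evaluation
across-realised N low  F F = ≤-by-evaluation
across-realised N high N N = ≤-by-evaluation
across-realised N high N F = ≤-by-evaluation
across-realised N high F N = ≤-by-evaluation
across-realised N high F F = ≤-by-evaluation
across-realised F low  N N = ≤-by-evaluation
across-realised F low  N F = ≤-by-evaluation
across-realised F low  F N = ≤-by-evaluation
across-realised F low  F F = ≤-by-evaluation
across-realised F high N N = ≤-by-evaluation
across-realised F high N F = ≤-by-evaluation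
across-realised F high F N = ≤-by-evaluation
across-realised F high F F = ≤-by-evaluation

module Chain {A : Set} (a₀ : A) (f g : ℤ → A → A)
             (f∘g : ∀ y a → f y (g y a) ≡ a) where

  σ : ℤ → A
  σ (+ zero)      = a₀
  σ (+ suc n)     = f (+ n) (σ (+ n))
  σ -[1+ zero ]   = g -[1+ zero ] a₀
  σ -[1+ suc n ]  = g -[1+ suc n ] (σ -[1+ n ])

  σ-step : ∀ y → σ (y +ᶻ + 1) ≡ f y (σ y)
  σ-step (+ n)          = cong (λ k → σ (+ k)) (ℕP.+-comm n 1)
  σ-step -[1+ zero ]    = sym (f∘g -[1+ zero ] a₀)
  σ-step -[1+ suc n ]   = sym (f∘g -[1+ suc n ] (σ -[1+ n ]))

-- The L-corner of square x + 1 is the right end of the edge hor x.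
pred-of-suc : ∀ x → (x +ᶻ + 1) -ᶻ + 1 ≡ x
pred-of-suc x = trans (ℤP.+-assoc x (+ 1) -[1+ 0 ]) (ℤP.+-identityʳ x)

module Colouring (ℓ : EdgeLabeling) where

  -- Walking up column x from B(x,y) through L(x,y) and T(x,y) to B(x,y+1).
  up down : ℤ → ℤ → Side → Side
  up   x y s = across (ℓ (ver (x , y))) (across (ℓ (sqTL (x , y))) (across (ℓ (sqLB (x , y))) s))
  down x y s = across (ℓ (sqLB (x , y))) (across (ℓ (sqTL (x , y))) (across (ℓ (ver (x , y))) s))

  up∘down : ∀ x y s → up x y (down x y s) ≡ s
  up∘down x y s = begin
      across v (across b (across c (across c (across b (across v s)))))
    ≡⟨ cong (λ t → across v (across b t)) (across-involutive c _) ⟩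
      across v (across b (across b (across v s)))
    ≡⟨ cong (across v) (across-involutive b _) ⟩
      across v (across v s)
    ≡⟨ across-involutive v s ⟩
      s
    ∎
    where
    open ≡-Reasoning
    v b c : Label
    v = ℓ (ver (x , y))
    b = ℓ (sqTL (x , y))
    c = ℓ (sqLB (x , y))

  sideB sideL sideT : ℤ → ℤ → Side
  sideB x = Chain.σ low (up x) (down x) (up∘down x)
  sideL x y = across (ℓ (sqLB (x , y))) (sideB x y)
  sideT x y = across (ℓ (sqTL (x , y))) (sideL x y)

  -- R-corners get 3; any other vertex gets the colour given by its side and by
  -- the label of its unique edge to an R-corner (hor (x - 1) for an L-corner).
  colour : V → ℕ
  colour (p , R)       = 3
  colour ((x , y) , T) = colourOf (sideT x y) (ℓ (sqRT (x , y)))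
  colour ((x , y) , L) = colourOf (sideL x y) (ℓ (hor (x -ᶻ + 1 , y)))
  colour ((x , y) , B) = colourOf (sideB x y) (ℓ (sqBR (x , y)))

  colour-range : ∀ v → (1 ≤ colour v) × (colour v ≤ 5)
  colour-range (p , R)       = ≤-by-evaluation , ≤-by-evaluation
  colour-range ((x , y) , T) = colourOf-range _ _
  colour-range ((x , y) , L) = colourOf-range _ _
  colour-range ((x , y) , B) = colourOf-range _ _

  -- Every edge of the tiling gets the colour difference its label asks for;
  -- the edge ver closing a step of a column is handled by Chain.σ-step.
  Realised : E → Set
  Realised e = let (u , v) = ends e in Realises (ℓ e) ∣ colour u - colour v ∣

  edge-realised : ∀ e → Realised e
  edge-realised (sqRT p@(x , y)) =
    realises-sym _ (colour (p , T)) 3 (centre-realised (sideT x y) (ℓ (sqRT p)))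
  edge-realised (sqTL p@(x , y)) =
    realises-sym _ (colour (p , L)) (colour (p , T))
      (across-realised _ (sideL x y) (ℓ (hor (x -ᶻ + 1 , y))) (ℓ (sqRT p)))
  edge-realised (sqLB p@(x , y)) =
    realises-sym _ (colour (p , B)) (colour (p , L))
      (across-realised _ (sideB x y) (ℓ (sqBR p)) (ℓ (hor (x -ᶻ + 1 , y))))
  edge-realised (sqBR p@(x , y)) = centre-realised (sideB x y) (ℓ (sqBR p))
  edge-realised (hor (x , y)) =
    subst (λ z → Realises (ℓ (hor (z , y))) ∣ 3 - colour (right , L) ∣)
          (pred-of-suc x)
          (realises-sym _ (colour (right , L)) 3
             (centre-realised (sideL (x +ᶻ + 1) y) (ℓ (hor ((x +ᶻ + 1) -ᶻ + 1 , y)))))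
    where
    right : Pt
    right = (x +ᶻ + 1 , y)
  edge-realised (ver (x , y)) =
    subst (λ s → Realises (ℓ (ver (x , y))) ∣ colour ((x , y) , T) - colourOf s (ℓ (sqBR above)) ∣)
          (sym (Chain.σ-step low (up x) (down x) (up∘down x) y))
          (across-realised _ (sideT x y) (ℓ (sqRT (x , y))) (ℓ (sqBR above)))
    where
    above : Pt
    above = (x , y +ᶻ + 1)

lemma6 : (G : OctSquareGrid) (ℓ : EdgeLabeling) →
    Σ (V → ℕ) (λ c → IsThresholdColoring 5 1 G ℓ c)
lemma6 G ℓ = colour
           , (λ v _ → colour-range v)
           , (λ e _ → realises⇒iff (ℓ e) _ (edge-realised e))
  where open Colouring ℓ
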